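{- For every integer $k \geq 2$ there is at most one positive integer $n$ such that $\sigma(n!) = k \cdot n!$.
   Context: $\sigma(m)$ is the sum of the positive divisors of $m$. -}

module Defs where

open import Data.Nat using (ℕ; suc)
open import Data.Nat.Divisibility using (_∣?_)
open import Data.List using (List; filter; map; upTo)
open import Data.Nat.ListAction using (sum)

range1 : ℕ → List ℕ
range1 m = map suc (upTo m)

σ : ℕ → ℕ
σ m = sum (filter (λ d → d ∣? m) (range1 m))

module Submission where

-- Write a = m ! and, for m < n, n ! = a · c with c ≥ 2.  Every divisor
-- d of a gives the divisor d · c of a · c, and 1 is a further divisor of a · c
-- not of that shape, so  c · σ a < σ (a · c)  for all a ≥ 1, c ≥ 2
-- (the abundancy σ(x)/x strictly grows when x passes to a proper multiple).
-- If both σ (m !) = k · m ! and σ (n !) = k · n ! held, then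
-- σ (n !) = k · a · c = c · σ a < σ (a · c) = σ (n !), a contradiction.

open import Defs
open import Data.Nat using (ℕ; _*_; _≥_; _!)
open import Relation.Binary.PropositionalEquality using (_≡_)

open import Data.Nat using (zero; suc; _+_; _∸_; _≤_; _<_; z≤n; s≤s; >-nonZero)
open import Data.Nat.Properties
open import Data.Nat.Divisibility
  using (_∣_; _∣?_; divides; 1∣_; ∣⇒≤; *-monoˡ-∣; m≤n⇒m!∣n!)
open import Data.Nat.ListAction using (sum)
open import Data.Nat.ListAction.Properties using (sum-++)
open import Data.List using ([]; _∷_; _++_; filter; map; upTo)
open import Data.List.Properties using (upTo-∷ʳ; map-++; filter-++)
open import Data.Product using (∃; _×_; _,_)
open import Data.Empty using (⊥; ⊥-elim)
open import Relation.Nullary using (yes; no; ¬_)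
open import Relation.Binary.Definitions using (tri<; tri≈; tri>)
open import Relation.Binary.PropositionalEquality
  using (refl; sym; trans; cong; subst; module ≡-Reasoning)

contribution : ℕ → ℕ → ℕ
contribution m d with d ∣? m
... | yes _ = d
... | no _  = 0

contribution-∣ : ∀ {m d} → d ∣ m → contribution m d ≡ d
contribution-∣ {m} {d} d∣m with d ∣? m
... | yes _   = refl
... | no d∤m = ⊥-elim (d∤m d∣m)

contribution-∤ : ∀ {m d} → ¬ d ∣ m → contribution m d ≡ 0
contribution-∤ {m} {d} d∤m with d ∣? m
... | yes d∣m = ⊥-elim (d∤m d∣m)
... | no _    = refl

sum-filter-singleton : ∀ m d → sum (filter (_∣? m) (d ∷ [])) ≡ contribution m d
sum-filter-singleton m d with d ∣? m
... | yes _ = +-identityʳ d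
... | no _  = refl

partialσ : ℕ → ℕ → ℕ
partialσ m n = sum (filter (_∣? m) (range1 n))

partialσ-suc : ∀ m n → partialσ m (suc n) ≡ partialσ m n + contribution m (suc n)
partialσ-suc m n = begin
  sum (filter P? (map suc (upTo (suc n))))          ≡⟨ cong (λ l → sum (filter P? (map suc l))) (sym (upTo-∷ʳ n)) ⟩
  sum (filter P? (map suc (upTo n ++ n ∷ [])))      ≡⟨ cong (λ l → sum (filter P? l)) (map-++ suc (upTo n) (n ∷ [])) ⟩
  sum (filter P? (range1 n ++ suc n ∷ []))          ≡⟨ cong sum (filter-++ P? (range1 n) (suc n ∷ [])) ⟩
  sum (filter P? (range1 n) ++ filter P? (suc n ∷ [])) ≡⟨ sum-++ (filter P? (range1 n)) _ ⟩
  partialσ m n + sum (filter P? (suc n ∷ []))       ≡⟨ cong (partialσ m n +_) (sum-filter-singleton m (suc n)) ⟩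
  partialσ m n + contribution m (suc n)             ∎
  where
  open ≡-Reasoning
  P? = _∣? m

partialσ-mono : ∀ m {n n′} → n ≤ n′ → partialσ m n ≤ partialσ m n′
partialσ-mono m {n} {n′} n≤n′ = subst (λ x → partialσ m n ≤ partialσ m x) (m∸n+n≡m n≤n′) (grow (n′ ∸ n))
  where
  grow : ∀ t → partialσ m n ≤ partialσ m (t + n)
  grow zero    = ≤-refl
  grow (suc t) = ≤-trans (grow t)
    (≤-trans (m≤m+n _ _) (≤-reflexive (sym (partialσ-suc m (t + n)))))

contribution-beyond : ∀ m → 1 ≤ m → contribution m (suc m) ≡ 0
contribution-beyond m 1≤m = contribution-∤ (λ sm∣m → n≮n m (∣⇒≤ {{>-nonZero 1≤m}} sm∣m))

contribution-scale : ∀ a c d → c * contribution a d ≤ contribution (a * c) (d * c)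
contribution-scale a c d with d ∣? a
... | yes d∣a = ≤-reflexive (trans (*-comm c d) (sym (contribution-∣ (*-monoˡ-∣ c d∣a))))
... | no _    = subst (_≤ contribution (a * c) (d * c)) (sym (*-zeroʳ c)) z≤n

-- Scaling the divisors of a in 1 … j by c ≥ 2 lands among the divisors of a · c
-- in 1 … j · c + 1, which moreover contain the divisor 1 ≠ d · c.  Induction on j:
-- the new term c · (j + 1) of a lies at (j + 1) · c, beyond the old range j · c + 1.
partialσ-scale : ∀ a c → 2 ≤ c → ∀ j → c * partialσ a j < partialσ (a * c) (suc (j * c))
partialσ-scale a c _ zero =
  ≤-reflexive (trans (cong suc (*-zeroʳ c))
    (sym (trans (partialσ-suc (a * c) 0) (contribution-∣ (1∣ (a * c))))))
partialσ-scale a c@(suc (suc c′)) 2≤c@(s≤s (s≤s _)) (suc j) = begin-strict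
  c * partialσ a (suc j)                                  ≡⟨ cong (c *_) (partialσ-suc a j) ⟩
  c * (partialσ a j + contribution a (suc j))             ≡⟨ *-distribˡ-+ c (partialσ a j) _ ⟩
  c * partialσ a j + c * contribution a (suc j)           <⟨ +-mono-<-≤ (partialσ-scale a c 2≤c j) (contribution-scale a c (suc j)) ⟩
  partialσ M (suc (j * c)) + contribution M (suc j * c)   ≤⟨ +-monoˡ-≤ _ (partialσ-mono M (s≤s (m≤n+m (j * c) c′))) ⟩
  partialσ M (suc (c′ + j * c)) + contribution M (suc j * c) ≡⟨ partialσ-suc M (suc (c′ + j * c)) ⟨
  partialσ M (suc j * c)                                  ≤⟨ partialσ-mono M (n≤1+n (suc j * c)) ⟩
  partialσ M (suc (suc j * c))                            ∎
  where
  open ≤-Reasoning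
  M = a * c

σ-scale : ∀ a c → 1 ≤ a → 2 ≤ c → c * σ a < σ (a * c)
σ-scale a c 1≤a 2≤c = begin-strict
  c * σ a                                              <⟨ partialσ-scale a c 2≤c a ⟩
  partialσ M (suc M)                                   ≡⟨ partialσ-suc M M ⟩
  partialσ M M + contribution M (suc M)                ≡⟨ cong (partialσ M M +_) (contribution-beyond M 1≤M) ⟩
  partialσ M M + 0                                     ≡⟨ +-identityʳ _ ⟩
  σ M                                                  ∎
  where
  open ≤-Reasoning
  M = a * c
  1≤M : 1 ≤ M
  1≤M = ≤-trans 1≤a (m≤m*n a c {{>-nonZero (≤-trans (s≤s z≤n) 2≤c)}})

-- For 1 ≤ m < n, n ! is a proper multiple of m !: it contains the factor m + 1 ≥ 2.
factorial-multiple : ∀ {m n} → 1 ≤ m → m < n → ∃ λ c → 2 ≤ c × n ! ≡ m ! * c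
factorial-multiple {m} {n} 1≤m m<n with m≤n⇒m!∣n! m<n
... | divides zero n!≡0 = ⊥-elim (n≮n 0 (subst (1 ≤_) n!≡0 (1≤n! n)))
... | divides (suc q) n!≡q[m+1]! =
  suc q * suc m , ≤-trans (s≤s 1≤m) (m≤n*m (suc m) (suc q)) , reorder
  where
  open ≡-Reasoning
  reorder : n ! ≡ m ! * (suc q * suc m)
  reorder = begin
    n !                      ≡⟨ n!≡q[m+1]! ⟩
    suc q * (suc m * m !)    ≡⟨ *-assoc (suc q) (suc m) (m !) ⟨
    (suc q * suc m) * m !    ≡⟨ *-comm (suc q * suc m) (m !) ⟩
    m ! * (suc q * suc m)    ∎

same-abundancy-impossible : ∀ k {m n} → 1 ≤ m → m < n →
  σ (m !) ≡ k * m ! → σ (n !) ≡ k * n ! → ⊥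
same-abundancy-impossible k {m} {n} 1≤m m<n σm! σn! with factorial-multiple 1≤m m<n
... | c , 2≤c , n!≡m!c = n≮n (σ (n !)) (begin-strict
  σ (n !)             ≡⟨ trans σn! (cong (k *_) n!≡m!c) ⟩
  k * (m ! * c)       ≡⟨ *-assoc k (m !) c ⟨
  (k * m !) * c       ≡⟨ cong (_* c) σm! ⟨
  σ (m !) * c         ≡⟨ *-comm (σ (m !)) c ⟩
  c * σ (m !)         <⟨ σ-scale (m !) c (1≤n! m) 2≤c ⟩
  σ (m ! * c)         ≡⟨ cong σ n!≡m!c ⟨
  σ (n !)             ∎)
  where open ≤-Reasoning

proposition6 : (k : ℕ) → k ≥ 2 → (m n : ℕ) → m ≥ 1 → n ≥ 1 → σ (m !) ≡ k * m ! → σ (n !) ≡ k * n ! → m ≡ n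
proposition6 k _ m n 1≤m 1≤n σm! σn! with <-cmp m n
... | tri< m<n _ _ = ⊥-elim (same-abundancy-impossible k 1≤m m<n σm! σn!)
... | tri≈ _ m≡n _ = m≡n
... | tri> _ _ n<m = ⊥-elim (same-abundancy-impossible k 1≤n n<m σn! σm!)
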